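{- Let $\mathcal{A}=(A,\to_\mathcal{A})$ be an abstract reduction system and $P,Q\subseteq A$. If $P\cap Q=\emptyset$ and $P\cap\mathrm{NF}_\mathcal{A}\neq\emptyset$, then $P\Rightarrow Q$ is not partially valid w.r.t. $\mathcal{A}$.
   Context: An abstract reduction system is a pair $\mathcal{A}=(A,\to_\mathcal{A})$ of a set $A$ and a binary relation on $A$; $\mathrm{NF}_\mathcal{A}$ is the set of normal forms; $\Delta_\mathcal{A}(P)=\{t\mid\exists s\in P.\ s\to_\mathcal{A}t\}$; $P$ is $\mathcal{A}$-runnable if $P\ne\emptyset$ and $P\cap\mathrm{NF}_\mathcal{A}=\emptyset$. An APR predicate is a pair $P\Rightarrow Q$ with $P,Q\subseteq A$. $P\Rightarrow Q$ is partially valid w.r.t. $\mathcal{A}$ if it lies in the greatest fixed point of the functional (mapping a set $X$ of APR predicates to the set of conclusions of rule instances whose premises are all in $X$ and whose side conditions hold) of the two rules: (Subsumption) no premises, conclusion $P\Rightarrow Q$, if $P\subseteq Q$; (Step) premise $\Delta_\mathcal{A}(P\setminus Q)\Rightarrow Q$, conclusion $P\Rightarrow Q$, if $P\setminus Q$ is $\mathcal{A}$-runnable. -}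

module Defs where

open import Level using (Level; _⊔_; suc)
open import Data.Product using (Σ; ∃; _×_; _,_)
open import Data.Sum using (_⊎_)
open import Relation.Nullary using (¬_)
open import Relation.Unary using (Pred; _⊆_; _∩_; _∖_; Satisfiable; Empty; _∈_)

record ARS (a r : Level) : Set (suc (a ⊔ r)) where
  field
    Carrier : Set a
    _⟶_     : Carrier → Carrier → Set r

module _ {a r : Level} (𝒜 : ARS a r) where
  open ARS 𝒜

  NF : Pred Carrier (a ⊔ r)
  NF s = ∀ t → ¬ (s ⟶ t)

  Δ : Pred Carrier (a ⊔ r) → Pred Carrier (a ⊔ r)
  Δ P t = ∃ λ s → P s × (s ⟶ t)

  Runnable : Pred Carrier (a ⊔ r) → Set (a ⊔ r)
  Runnable P = Satisfiable P × Empty (P ∩ NF)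

  -- sets of APR predicates P ⇒ Q (represented as pairs of subsets)
  APRSet : Set (suc (a ⊔ r))
  APRSet = Pred Carrier (a ⊔ r) → Pred Carrier (a ⊔ r) → Set (a ⊔ r)

  -- the functional of the rules (Subsumption) and (Step)
  Φ : APRSet → APRSet
  Φ X P Q = (P ⊆ Q) ⊎ (Runnable (P ∖ Q) × X (Δ (P ∖ Q)) Q)

  -- the greatest fixed point of Φ, as the union of all post-fixed points (Knaster–Tarski)
  PartiallyValid : Pred Carrier (a ⊔ r) → Pred Carrier (a ⊔ r) → Set (suc (a ⊔ r))
  PartiallyValid P Q =
    Σ APRSet λ X → (∀ P′ Q′ → X P′ Q′ → Φ X P′ Q′) × X P Q

module Submission where

open import Defs
open import Level using (Level; _⊔_)
open import Relation.Nullary using (¬_)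
open import Relation.Unary using (Pred; _∩_; _⊆_; _∖_; Satisfiable; Empty)
open import Data.Product using (_,_)
open import Data.Sum using (_⊎_; inj₁; inj₂)

module _ {a r : Level} (𝒜 : ARS a r) where

  partiallyValid⇒⊆⊎runnable : ∀ {P Q} → PartiallyValid 𝒜 P Q →
    P ⊆ Q ⊎ Runnable 𝒜 (P ∖ Q)
  partiallyValid⇒⊆⊎runnable {P} {Q} (X , postFixed , P⇒Q) with postFixed P Q P⇒Q
  ... | inj₁ P⊆Q            = inj₁ P⊆Q
  ... | inj₂ (runnable , _) = inj₂ runnable

  disjoint∧normalForm⇒¬runnable : ∀ {P Q : Pred (ARS.Carrier 𝒜) (a ⊔ r)} →
    Empty (P ∩ Q) → Satisfiable (P ∩ NF 𝒜) → ¬ Runnable 𝒜 (P ∖ Q)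
  disjoint∧normalForm⇒¬runnable disjoint (s , s∈P , s∈NF) (_ , noNormalForm) =
    noNormalForm s ((s∈P , λ s∈Q → disjoint s (s∈P , s∈Q)) , s∈NF)

  disjoint∧satisfiable⇒¬⊆ : ∀ {P Q : Pred (ARS.Carrier 𝒜) (a ⊔ r)} →
    Empty (P ∩ Q) → Satisfiable P → ¬ P ⊆ Q
  disjoint∧satisfiable⇒¬⊆ disjoint (s , s∈P) P⊆Q = disjoint s (s∈P , P⊆Q s∈P)

proposition9 : ∀ {a r : Level} (𝒜 : ARS a r) (P Q : Pred (ARS.Carrier 𝒜) (a ⊔ r)) →
    Empty (P ∩ Q) → Satisfiable (P ∩ NF 𝒜) → ¬ PartiallyValid 𝒜 P Q
proposition9 𝒜 P Q disjoint normalForm@(s , s∈P , _) valid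
  with partiallyValid⇒⊆⊎runnable 𝒜 valid
... | inj₁ P⊆Q     = disjoint∧satisfiable⇒¬⊆ 𝒜 disjoint (s , s∈P) P⊆Q
... | inj₂ runnable = disjoint∧normalForm⇒¬runnable 𝒜 disjoint normalForm runnable
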